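{- Let $G$ be a connected finite simple graph containing none of the claw, the co-diamond, $K_4$ as an induced subgraph, with $\alpha(G)=3$ and containing a triangle. Then $G$ has at most $18$ vertices.
   Context: $\alpha(G)$ is the maximum size of a stable set in $G$. Claw $=K_{1,3}$; co-diamond $=$ one edge plus two isolated vertices; $K_4$ is the complete graph on four vertices. -}

module Defs where

open import Data.Nat using (ℕ; suc)
open import Data.Fin using (Fin; zero; suc)
open import Data.Bool using (Bool; true; false)
open import Data.List using (List; []; _∷_)
open import Data.Product using (Σ; _×_; _,_; ∃)
open import Relation.Binary.PropositionalEquality using (_≡_; _≢_)
open import Relation.Nullary using (¬_)
open import Function.Definitions using (Injective)

record Graph (n : ℕ) : Set where
  field
    adj   : Fin n → Fin n → Bool
    sym   : ∀ u v → adj u v ≡ adj v u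
    irrefl : ∀ v → adj v v ≡ false
open Graph public

data Walk {n : ℕ} (G : Graph n) : Fin n → Fin n → Set where
  here : ∀ {u} → Walk G u u
  step : ∀ {u w v} → adj G u w ≡ true → Walk G w v → Walk G u v

Connected : ∀ {n} → Graph n → Set
Connected G = ∀ u v → Walk G u v

IsInducedSubgraph : ∀ {k n} → Graph k → Graph n → Set
IsInducedSubgraph {k} {n} H G =
  Σ (Fin k → Fin n) λ f →
    Injective _≡_ _≡_ f × (∀ u v → adj G (f u) (f v) ≡ adj H u v)

StableOfSize : ∀ {n} → Graph n → ℕ → Set
StableOfSize {n} G k =
  Σ (Fin k → Fin n) λ f →
    Injective _≡_ _≡_ f × (∀ i j → adj G (f i) (f j) ≡ false)

AlphaEq : ∀ {n} → Graph n → ℕ → Set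
AlphaEq G k = StableOfSize G k × ¬ StableOfSize G (suc k)

claw-adj : Fin 4 → Fin 4 → Bool
claw-adj zero (suc _) = true
claw-adj (suc _) zero = true
claw-adj _ _ = false

claw : Graph 4
claw = record { adj = claw-adj ; sym = s ; irrefl = i }
  where
  s : ∀ u v → claw-adj u v ≡ claw-adj v u
  s zero zero = _≡_.refl
  s zero (suc v) = _≡_.refl
  s (suc u) zero = _≡_.refl
  s (suc u) (suc v) = _≡_.refl
  i : ∀ v → claw-adj v v ≡ false
  i zero = _≡_.refl
  i (suc v) = _≡_.refl

codiamond-adj : Fin 4 → Fin 4 → Bool
codiamond-adj zero (suc zero) = true
codiamond-adj (suc zero) zero = true
codiamond-adj _ _ = false

codiamond : Graph 4
codiamond = record { adj = codiamond-adj ; sym = s ; irrefl = i }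
  where
  s : ∀ u v → codiamond-adj u v ≡ codiamond-adj v u
  s zero zero = _≡_.refl
  s zero (suc zero) = _≡_.refl
  s zero (suc (suc v)) = _≡_.refl
  s (suc zero) zero = _≡_.refl
  s (suc (suc u)) zero = _≡_.refl
  s (suc zero) (suc zero) = _≡_.refl
  s (suc zero) (suc (suc v)) = _≡_.refl
  s (suc (suc u)) (suc zero) = _≡_.refl
  s (suc (suc u)) (suc (suc v)) = _≡_.refl
  i : ∀ v → codiamond-adj v v ≡ false
  i zero = _≡_.refl
  i (suc zero) = _≡_.refl
  i (suc (suc v)) = _≡_.refl

K-adj : ∀ {m} → Fin m → Fin m → Bool
K-adj zero zero = false
K-adj zero (suc _) = true
K-adj (suc _) zero = true
K-adj (suc u) (suc v) = K-adj u v

K : (m : ℕ) → Graph m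
K m = record { adj = K-adj ; sym = s ; irrefl = i }
  where
  s : ∀ {m} (u v : Fin m) → K-adj u v ≡ K-adj v u
  s zero zero = _≡_.refl
  s zero (suc v) = _≡_.refl
  s (suc u) zero = _≡_.refl
  s (suc u) (suc v) = s u v
  i : ∀ {m} (v : Fin m) → K-adj v v ≡ false
  i zero = _≡_.refl
  i (suc v) = i v

-- G contains a triangle (as a subgraph; for triangles this is the same as induced).
HasTriangle : ∀ {n} → Graph n → Set
HasTriangle G = IsInducedSubgraph (K 3) G

module Submission where

-- Only claw-freeness, K₄-freeness and α(G) ≤ 3 are needed, and
-- they already give the stronger bound n ≤ 15.  Fix a vertex v (a corner of
-- the given triangle) and split the vertex set into v, its neighbourhood
-- N(v) and its non-neighbourhood M(v) (written full ∖ N v - v below).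
--   * N(v) has no triangle (with v it would be a K₄) and no stable triple
--     (with v it would be a claw), so |N(v)| < R(3,3) = 6.
--   * M(v) has no K₄ and no stable triple (with v it would be a stable set
--     of size 4), so |M(v)| < R(4,3) = 10.
-- Hence n ≤ 1 + 5 + 9 = 15 ≤ 18.

open import Defs
open import Data.Nat using (ℕ; _≤_)
open import Relation.Nullary using (¬_)

open import Data.Nat using (zero; suc; _+_; _<_; z≤n; s≤s; s≤s⁻¹; _≤?_)
open import Data.Nat.Properties
  using (≤-trans; ≤-reflexive; m≤n⇒m≤1+n; m≤m+n; +-suc;
         +-mono-≤; +-monoˡ-≤; +-monoʳ-≤;
         ≰⇒>; 1+n≰n; module ≤-Reasoning)
open import Data.Fin using (Fin; _≟_) renaming (zero to fzero; suc to fsuc)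
open import Data.Bool using (Bool; true; false; _∧_; not)
open import Data.Bool.Properties using (∧-conicalˡ; ∧-conicalʳ)
open import Data.Vec.Functional using (_∷_; head; tail)
open import Data.Product using (Σ; ∃; _×_; _,_)
open import Data.Sum using (_⊎_; inj₁; inj₂)
open import Data.Empty using (⊥-elim)
open import Relation.Nullary using (yes; no; does; contradiction)
open import Relation.Nullary.Decidable using (dec-true)
open import Relation.Binary.PropositionalEquality
  using (_≡_; _≢_; refl; trans; cong) renaming (sym to ≡-sym)
open import Function.Definitions using (Injective)

VertexSet : ℕ → Set
VertexSet n = Fin n → Bool

module _ {n : ℕ} where

  infix 4 _∈_ _⊆_
  infixl 6 _∩_ _∖_ _-_

  _∈_ : Fin n → VertexSet n → Set
  u ∈ p = p u ≡ true

  _⊆_ : VertexSet n → VertexSet n → Set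
  p ⊆ q = ∀ u → u ∈ p → u ∈ q

  full : VertexSet n
  full _ = true

  ⁅_⁆ : Fin n → VertexSet n
  ⁅ w ⁆ u = does (u ≟ w)

  _∩_ _∖_ : VertexSet n → VertexSet n → VertexSet n
  (p ∩ q) u = p u ∧ q u
  (p ∖ q) u = p u ∧ not (q u)

  _-_ : VertexSet n → Fin n → VertexSet n
  p - w = p ∖ ⁅ w ⁆

  ∩-⊆ˡ : ∀ p q → p ∩ q ⊆ p
  ∩-⊆ˡ p q u = ∧-conicalˡ (p u) (q u)

  ∩-⊆ʳ : ∀ p q → p ∩ q ⊆ q
  ∩-⊆ʳ p q u = ∧-conicalʳ (p u) (q u)

  ∖-⊆ : ∀ p q → p ∖ q ⊆ p
  ∖-⊆ p q u = ∧-conicalˡ (p u) (not (q u))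

  ∖-outside : ∀ p q u → u ∈ p ∖ q → q u ≡ false
  ∖-outside p q u u∈p∖q with q u | ∧-conicalʳ (p u) _ u∈p∖q
  ... | false | _ = refl

  ∈-≢ : ∀ p w u → u ∈ p - w → u ≢ w
  ∈-≢ p w u u∈p-w u≡w =
    contradiction (trans (≡-sym (dec-true (u ≟ w) u≡w)) (∖-outside p ⁅ w ⁆ u u∈p-w))
                  λ ()

size : ∀ {n} → VertexSet n → ℕ
size {zero}  p = 0
size {suc n} p = indicator (head p) + size (tail p)
  where
  indicator : Bool → ℕ
  indicator true  = 1
  indicator false = 0

size-full : ∀ n → size (full {n}) ≡ n
size-full zero    = refl
size-full (suc n) = cong suc (size-full n)

size-mono : ∀ {n} (p q : VertexSet n) → p ⊆ q → size p ≤ size q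
size-mono {zero}  p q p⊆q = z≤n
size-mono {suc n} p q p⊆q with head p in p₀ | head q in q₀
... | true  | true  = s≤s (size-mono (tail p) (tail q) (λ u → p⊆q (fsuc u)))
... | false | true  = m≤n⇒m≤1+n (size-mono (tail p) (tail q) (λ u → p⊆q (fsuc u)))
... | false | false = size-mono (tail p) (tail q) (λ u → p⊆q (fsuc u))
... | true  | false = contradiction (trans (≡-sym (p⊆q fzero p₀)) q₀) λ ()

size-split : ∀ {n} (p q : VertexSet n) → size p ≡ size (p ∩ q) + size (p ∖ q)
size-split {zero}  p q = refl
size-split {suc n} p q with head p | head q
... | true  | true  = cong suc (size-split (tail p) (tail q))
... | true  | false = trans (cong suc (size-split (tail p) (tail q))) (≡-sym (+-suc _ _))
... | false | _     = size-split (tail p) (tail q)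

size-empty : ∀ n → size (λ (_ : Fin n) → false) ≡ 0
size-empty zero    = refl
size-empty (suc n) = size-empty n

size-singleton : ∀ {n} (w : Fin n) → size ⁅ w ⁆ ≤ 1
size-singleton {suc n} fzero    = s≤s (≤-reflexive (size-empty n))
size-singleton {suc n} (fsuc w) = size-singleton w

size-remove : ∀ {n} (p : VertexSet n) (w : Fin n) → size p ≤ suc (size (p - w))
size-remove p w = begin
  size p                           ≡⟨ size-split p ⁅ w ⁆ ⟩
  size (p ∩ ⁅ w ⁆) + size (p - w)  ≤⟨ +-monoˡ-≤ (size (p - w)) at-most-w ⟩
  suc (size (p - w))               ∎
  where
  open ≤-Reasoning
  at-most-w : size (p ∩ ⁅ w ⁆) ≤ 1
  at-most-w = ≤-trans (size-mono (p ∩ ⁅ w ⁆) ⁅ w ⁆ (∩-⊆ʳ p ⁅ w ⁆)) (size-singleton w)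

member : ∀ {n} (p : VertexSet n) → 1 ≤ size p → ∃ λ w → w ∈ p
member {suc n} p pos with head p in p₀
... | true  = fzero , p₀
... | false with member (tail p) pos
...   | w , w∈p = fsuc w , w∈p

pigeonhole : ∀ a b x y → a + b ≤ suc (x + y) → a ≤ x ⊎ b ≤ y
pigeonhole a b x y a+b≤ with a ≤? x | b ≤? y
... | yes a≤x | _       = inj₁ a≤x
... | no _    | yes b≤y = inj₂ b≤y
... | no a≰x  | no b≰y  = contradiction too-big 1+n≰n
  where
  too-big : suc (suc (x + y)) ≤ suc (x + y)
  too-big = begin
    suc (suc (x + y)) ≡⟨ cong suc (≡-sym (+-suc x y)) ⟩
    suc x + suc y     ≤⟨ +-mono-≤ (≰⇒> a≰x) (≰⇒> b≰y) ⟩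
    a + b             ≤⟨ a+b≤ ⟩
    suc (x + y)       ∎
    where open ≤-Reasoning

K-adj-refl : ∀ {k} (i : Fin k) → K-adj i i ≡ false
K-adj-refl fzero    = refl
K-adj-refl (fsuc i) = K-adj-refl i

K-adj-distinct : ∀ {k} (i j : Fin k) → i ≢ j → K-adj i j ≡ true
K-adj-distinct fzero    fzero    i≢j = contradiction refl i≢j
K-adj-distinct fzero    (fsuc j) _   = refl
K-adj-distinct (fsuc i) fzero    _   = refl
K-adj-distinct (fsuc i) (fsuc j) i≢j = K-adj-distinct i j (λ i≡j → i≢j (cong fsuc i≡j))

-- The Erdős–Szekeres recursion: ramsey s t bounds the Ramsey number
-- R(s+1, t+1) from above; ramsey 2 2 = 6 and ramsey 3 2 = 10.
ramsey : ℕ → ℕ → ℕ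
ramsey zero    t       = 1
ramsey (suc s) zero    = 1
ramsey (suc s) (suc t) = ramsey s (suc t) + ramsey (suc s) t

ramsey-pos : ∀ s t → 1 ≤ ramsey s t
ramsey-pos zero    t       = s≤s z≤n
ramsey-pos (suc s) zero    = s≤s z≤n
ramsey-pos (suc s) (suc t) = ≤-trans (ramsey-pos s (suc t)) (m≤m+n _ _)

module _ {n : ℕ} (G : Graph n) where

  N : Fin n → VertexSet n
  N w = adj G w

  -- s vertices of p, pairwise adjacent (hence automatically distinct).
  Clique : VertexSet n → ℕ → Set
  Clique p s = Σ (Fin s → Fin n) λ f → (∀ i → f i ∈ p) ×
                 (∀ i j → i ≢ j → adj G (f i) (f j) ≡ true)

  Stable : VertexSet n → ℕ → Set
  Stable p s = Σ (Fin s → Fin n) λ f → (∀ i → f i ∈ p) ×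
                 Injective _≡_ _≡_ f × (∀ i j → adj G (f i) (f j) ≡ false)

  adjacent⇒distinct : ∀ {u w} → adj G u w ≡ true → u ≢ w
  adjacent⇒distinct {u} u~w refl = contradiction (trans (≡-sym u~w) (irrefl G u)) λ ()

  clique-⊆ : ∀ p q {s} → p ⊆ q → Clique p s → Clique q s
  clique-⊆ p q p⊆q (f , f∈p , f-adj) = f , (λ i → p⊆q (f i) (f∈p i)) , f-adj

  stable-⊆ : ∀ p q {s} → p ⊆ q → Stable p s → Stable q s
  stable-⊆ p q p⊆q (f , f∈p , f-inj , f-nonadj) =
    f , (λ i → p⊆q (f i) (f∈p i)) , f-inj , f-nonadj

  clique-extend : ∀ p w {s} → w ∈ p → Clique (p ∩ N w) s → Clique p (suc s)
  clique-extend p w {s} w∈p (f , f∈ , f-adj) = w ∷ f , g∈p , g-adj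
    where
    g∈p : ∀ i → (w ∷ f) i ∈ p
    g∈p fzero    = w∈p
    g∈p (fsuc i) = ∩-⊆ˡ p (N w) (f i) (f∈ i)
    w~f : ∀ i → adj G w (f i) ≡ true
    w~f i = ∩-⊆ʳ p (N w) (f i) (f∈ i)
    g-adj : ∀ i j → i ≢ j → adj G ((w ∷ f) i) ((w ∷ f) j) ≡ true
    g-adj fzero    fzero    i≢j = contradiction refl i≢j
    g-adj fzero    (fsuc j) _   = w~f j
    g-adj (fsuc i) fzero    _   = trans (Graph.sym G (f i) w) (w~f i)
    g-adj (fsuc i) (fsuc j) i≢j = f-adj i j (λ i≡j → i≢j (cong fsuc i≡j))

  stable-extend : ∀ p w {s} → w ∈ p → Stable (p ∖ N w - w) s → Stable p (suc s)
  stable-extend p w {s} w∈p (f , f∈ , f-inj , f-nonadj) = w ∷ f , g∈p , g-inj , g-nonadj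
    where
    f∈p∖N : ∀ i → f i ∈ p ∖ N w
    f∈p∖N i = ∖-⊆ (p ∖ N w) ⁅ w ⁆ (f i) (f∈ i)
    g∈p : ∀ i → (w ∷ f) i ∈ p
    g∈p fzero    = w∈p
    g∈p (fsuc i) = ∖-⊆ p (N w) (f i) (f∈p∖N i)
    w≁f : ∀ i → adj G w (f i) ≡ false
    w≁f i = ∖-outside p (N w) (f i) (f∈p∖N i)
    w≢f : ∀ i → w ≢ f i
    w≢f i w≡f = ∈-≢ (p ∖ N w) w (f i) (f∈ i) (≡-sym w≡f)
    g-inj : Injective _≡_ _≡_ (w ∷ f)
    g-inj {fzero}  {fzero}  _ = refl
    g-inj {fzero}  {fsuc j} e = ⊥-elim (w≢f j e)
    g-inj {fsuc i} {fzero}  e = ⊥-elim (w≢f i (≡-sym e))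
    g-inj {fsuc i} {fsuc j} e = cong fsuc (f-inj e)
    g-nonadj : ∀ i j → adj G ((w ∷ f) i) ((w ∷ f) j) ≡ false
    g-nonadj fzero    fzero    = irrefl G w
    g-nonadj fzero    (fsuc j) = w≁f j
    g-nonadj (fsuc i) fzero    = trans (Graph.sym G (f i) w) (w≁f i)
    g-nonadj (fsuc i) (fsuc j) = f-nonadj i j

  size-partition : ∀ p w → size p ≤ suc (size (p ∩ N w) + size (p ∖ N w - w))
  size-partition p w = begin
    size p                                     ≡⟨ size-split p (N w) ⟩
    size (p ∩ N w) + size (p ∖ N w)            ≤⟨ +-monoʳ-≤ (size (p ∩ N w)) (size-remove (p ∖ N w) w) ⟩
    size (p ∩ N w) + suc (size (p ∖ N w - w))  ≡⟨ +-suc _ _ ⟩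
    suc (size (p ∩ N w) + size (p ∖ N w - w))  ∎
    where open ≤-Reasoning

  member-clique : ∀ p → (∃ λ w → w ∈ p) → Clique p 1
  member-clique p (w , w∈p) =
    (λ _ → w) , (λ _ → w∈p) , λ { fzero fzero 0≢0 → contradiction refl 0≢0 }

  member-stable : ∀ p → (∃ λ w → w ∈ p) → Stable p 1
  member-stable p (w , w∈p) =
    (λ _ → w) , (λ _ → w∈p) , (λ { {fzero} {fzero} _ → refl }) , λ _ _ → irrefl G w

  ramsey-theorem : ∀ s t (p : VertexSet n) → ramsey s t ≤ size p →
                   Clique p (suc s) ⊎ Stable p (suc t)
  ramsey-theorem zero    t    p big = inj₁ (member-clique p (member p big))
  ramsey-theorem (suc s) zero p big = inj₂ (member-stable p (member p big))
  -- Split p at a vertex w; its neighbours or its non-neighbours are numerous.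
  ramsey-theorem (suc s) (suc t) p big
    with member p (≤-trans (ramsey-pos (suc s) (suc t)) big)
  ... | w , w∈p
    with pigeonhole (ramsey s (suc t)) (ramsey (suc s) t) _ _
                    (≤-trans big (size-partition p w))
  ... | inj₁ big-N with ramsey-theorem s (suc t) (p ∩ N w) big-N
  ...   | inj₁ c = inj₁ (clique-extend p w w∈p c)
  ...   | inj₂ a = inj₂ (stable-⊆ (p ∩ N w) p (∩-⊆ˡ p (N w)) a)
  ramsey-theorem (suc s) (suc t) p big | w , w∈p | inj₂ big-M
    with ramsey-theorem (suc s) t (p ∖ N w - w) big-M
  ...   | inj₁ c = inj₁ (clique-⊆ (p ∖ N w - w) p non-neighbours-⊆ c)
    where
    non-neighbours-⊆ : p ∖ N w - w ⊆ p
    non-neighbours-⊆ u u∈ = ∖-⊆ p (N w) u (∖-⊆ (p ∖ N w) ⁅ w ⁆ u u∈)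
  ...   | inj₂ a = inj₂ (stable-extend p w w∈p a)

  ramsey-bound : ∀ s t (p : VertexSet n) → ¬ Clique p (suc s) → ¬ Stable p (suc t) →
                 size p < ramsey s t
  ramsey-bound s t p no-clique no-stable with ramsey s t ≤? size p
  ... | yes big = contradiction (ramsey-theorem s t p big) λ where
                    (inj₁ c) → no-clique c
                    (inj₂ a) → no-stable a
  ... | no small = ≰⇒> small

  clique⇒K : ∀ {p m} → Clique p m → IsInducedSubgraph (K m) G
  clique⇒K {m = m} (f , _ , f-adj) = f , f-inj , f-induced
    where
    f-inj : Injective _≡_ _≡_ f
    f-inj {i} {j} fi≡fj with i ≟ j
    ... | yes i≡j = i≡j
    ... | no  i≢j = contradiction fi≡fj (adjacent⇒distinct (f-adj i j i≢j))
    f-induced : ∀ i j → adj G (f i) (f j) ≡ adj (K m) i j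
    f-induced i j with i ≟ j
    ... | yes refl = trans (irrefl G (f i)) (≡-sym (K-adj-refl i))
    ... | no  i≢j  = trans (f-adj i j i≢j) (≡-sym (K-adj-distinct i j i≢j))

  stable⇒StableOfSize : ∀ {p s} → Stable p s → StableOfSize G s
  stable⇒StableOfSize (f , _ , f-inj , f-nonadj) = f , f-inj , f-nonadj

  stable-neighbours⇒claw : ∀ v → Stable (N v) 3 → IsInducedSubgraph claw G
  stable-neighbours⇒claw v (f , v~f , f-inj , f-nonadj) = v ∷ f , g-inj , g-induced
    where
    g-inj : Injective _≡_ _≡_ (v ∷ f)
    g-inj {fzero}  {fzero}  _ = refl
    g-inj {fzero}  {fsuc j} e = ⊥-elim (adjacent⇒distinct (v~f j) e)
    g-inj {fsuc i} {fzero}  e = ⊥-elim (adjacent⇒distinct (v~f i) (≡-sym e))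
    g-inj {fsuc i} {fsuc j} e = cong fsuc (f-inj e)
    g-induced : ∀ a b → adj G ((v ∷ f) a) ((v ∷ f) b) ≡ adj claw a b
    g-induced fzero    fzero    = irrefl G v
    g-induced fzero    (fsuc j) = v~f j
    g-induced (fsuc i) fzero    = trans (Graph.sym G (f i) v) (v~f i)
    g-induced (fsuc i) (fsuc j) = f-nonadj i j

  degree-bound : ¬ IsInducedSubgraph claw G → ¬ IsInducedSubgraph (K 4) G →
                 ∀ v → size (N v) ≤ 5
  degree-bound no-claw no-K4 v = s≤s⁻¹ (ramsey-bound 2 2 (N v) no-triangle no-stable-triple)
    where
    no-triangle : ¬ Clique (N v) 3
    no-triangle K₃ = no-K4 (clique⇒K {p = full} (clique-extend full v refl K₃))
    no-stable-triple : ¬ Stable (N v) 3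
    no-stable-triple S = no-claw (stable-neighbours⇒claw v S)

  non-degree-bound : ¬ IsInducedSubgraph (K 4) G → ¬ StableOfSize G 4 →
                     ∀ v → size (full ∖ N v - v) ≤ 9
  non-degree-bound no-K4 no-stable4 v =
    s≤s⁻¹ (ramsey-bound 3 2 (full ∖ N v - v) no-K4-inside no-stable-triple)
    where
    no-K4-inside : ¬ Clique (full ∖ N v - v) 4
    no-K4-inside K₄ = no-K4 (clique⇒K {p = full ∖ N v - v} K₄)
    no-stable-triple : ¬ Stable (full ∖ N v - v) 3
    no-stable-triple S = no-stable4 (stable⇒StableOfSize {p = full} (stable-extend full v refl S))

lemma12 : (n : ℕ) (G : Graph n) →
    Connected G →
    ¬ IsInducedSubgraph claw G →
    ¬ IsInducedSubgraph codiamond G →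
    ¬ IsInducedSubgraph (K 4) G →
    AlphaEq G 3 →
    HasTriangle G →
    n ≤ 18
lemma12 n G _ no-claw _ no-K4 (_ , no-stable4) (triangle , _) = begin
  n                                             ≡⟨ ≡-sym (size-full n) ⟩
  size (full {n})                               ≤⟨ size-partition G full v ⟩
  suc (size (N G v) + size (full ∖ N G v - v))  ≤⟨ s≤s (+-mono-≤ degree non-degree) ⟩
  15                                            ≤⟨ m≤m+n 15 3 ⟩
  18                                            ∎
  where
  open ≤-Reasoning
  v : Fin n
  v = triangle fzero
  degree : size (N G v) ≤ 5
  degree = degree-bound G no-claw no-K4 v
  non-degree : size (full ∖ N G v - v) ≤ 9
  non-degree = non-degree-bound G no-K4 no-stable4 v
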